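{- Let $\Delta(m,n)$ denote the discriminant of the characteristic polynomial of the matrix $\begin{pmatrix}0&0&1\\1&0&m\\0&1&n\end{pmatrix}$, $(m,n)\in\mathbb{R}^2$. Then every real solution $(m,n)$ of $\Delta(m,n)=0$ satisfies $$(m^2-4n+3)(n^2+4m+3)\ge 0\quad\text{and}\quad (m^2-4n-3)(n^2+4m-3)-72\le 0.$$ -}

module Defs where

open import Level using (Level; _⊔_) renaming (suc to lsuc)
open import Data.Nat as ℕ using (ℕ)
open import Data.Fin as F using (Fin)
open import Data.Product using (Σ; _×_; _,_)
open import Relation.Nullary using (¬_)
open import Relation.Binary using (Rel; IsTotalOrder)
open import Relation.Unary using (Pred)
open import Algebra.Bundles using (CommutativeRing)

-- The real numbers, axiomatised as a complete ordered field
-- (unique up to isomorphism; agda-stdlib has no ℝ).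
record RealField (c ℓ₁ ℓ₂ : Level) : Set (lsuc (c ⊔ ℓ₁ ⊔ ℓ₂)) where
  field
    commutativeRing : CommutativeRing c ℓ₁
  open CommutativeRing commutativeRing public
  field
    _≤_          : Rel Carrier ℓ₂
    isTotalOrder : IsTotalOrder _≈_ _≤_
    +-mono-≤     : ∀ {x y} z → x ≤ y → (x + z) ≤ (y + z)
    *-nonneg     : ∀ {x y} → 0# ≤ x → 0# ≤ y → 0# ≤ (x * y)
    0≉1          : ¬ (0# ≈ 1#)
    inverse      : ∀ x → ¬ (x ≈ 0#) → Σ Carrier (λ y → (x * y) ≈ 1#)
    lub : (P : Pred Carrier ℓ₂) → Σ Carrier P →
          Σ Carrier (λ b → ∀ x → P x → x ≤ b) →
          Σ Carrier (λ s → (∀ x → P x → x ≤ s) ×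
                           (∀ b → (∀ x → P x → x ≤ b) → s ≤ b))

module RealDefs {c ℓ₁ ℓ₂} (R : RealField c ℓ₁ ℓ₂) where
  open RealField R hiding (zero)

  lit : ℕ → Carrier
  lit ℕ.zero    = 0#
  lit (ℕ.suc k) = 1# + lit k

  Matrix3 : Set c
  Matrix3 = Fin 3 → Fin 3 → Carrier

  f0 f1 f2 : Fin 3
  f0 = F.zero
  f1 = F.suc F.zero
  f2 = F.suc (F.suc F.zero)

  trace3 : Matrix3 → Carrier
  trace3 A = A f0 f0 + A f1 f1 + A f2 f2

  minors3 : Matrix3 → Carrier
  minors3 A = (A f0 f0 * A f1 f1 - A f0 f1 * A f1 f0)
            + (A f0 f0 * A f2 f2 - A f0 f2 * A f2 f0)
            + (A f1 f1 * A f2 f2 - A f1 f2 * A f2 f1)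

  det3 : Matrix3 → Carrier
  det3 A = A f0 f0 * (A f1 f1 * A f2 f2 - A f1 f2 * A f2 f1)
         - A f0 f1 * (A f1 f0 * A f2 f2 - A f1 f2 * A f2 f0)
         + A f0 f2 * (A f1 f0 * A f2 f1 - A f1 f1 * A f2 f0)

  -- discriminant of the monic cubic x³ + b x² + c' x + d
  discCubic : Carrier → Carrier → Carrier → Carrier
  discCubic b c' d =
      lit 18 * b * c' * d
    - lit 4 * (b * b * b) * d
    + b * b * (c' * c')
    - lit 4 * (c' * c' * c')
    - lit 27 * (d * d)

  -- characteristic polynomial det(xI - A) = x³ - tr(A) x² + minors(A) x - det(A)
  charPolyDisc : Matrix3 → Carrier
  charPolyDisc A = discCubic (- trace3 A) (minors3 A) (- det3 A)

  M : Carrier → Carrier → Matrix3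
  M m n F.zero F.zero = 0#
  M m n F.zero (F.suc F.zero) = 0#
  M m n F.zero (F.suc (F.suc F.zero)) = 1#
  M m n (F.suc F.zero) F.zero = 1#
  M m n (F.suc F.zero) (F.suc F.zero) = 0#
  M m n (F.suc F.zero) (F.suc (F.suc F.zero)) = m
  M m n (F.suc (F.suc F.zero)) F.zero = 0#
  M m n (F.suc (F.suc F.zero)) (F.suc F.zero) = 1#
  M m n (F.suc (F.suc F.zero)) (F.suc (F.suc F.zero)) = n

  Δ : Carrier → Carrier → Carrier
  Δ m n = charPolyDisc (M m n)

{-# OPTIONS --safe #-}
-- Δ(m, n) is the discriminant of x³ − n x² − m x − 1.  Each of the two
-- quartics differs from Δ by a sum of squares:
--   (m² − 4n + 3)(n² + 4m + 3)      = Δ + 2(m + n)² + (m − n + 6)²,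
--   (m² − 4n − 3)(n² + 4m − 3) − 72 = Δ − (m + n)² − 2(m − n + 3)² − 18,
-- so on the curve Δ = 0 the first is nonnegative and the second nonpositive.
module Submission where

open import Algebra.Bundles using (CommutativeRing)
import Algebra.Properties.Ring as RingProperties
import Algebra.Properties.Semiring.Mult as SemiringMult
open import Algebra.Solver.Ring.AlmostCommutativeRing
  using (_-Raw-AlmostCommutative⟶_; fromCommutativeRing)
import Algebra.Solver.Ring as RingSolver
open import Data.Integer as ℤ using (ℤ; +_; -[1+_]; _◃_; sign; ∣_∣)
import Data.Integer.Properties as ℤ
open import Data.Maybe using (just; nothing)
open import Data.Nat as ℕ using (ℕ)
import Data.Nat.Properties as ℕ
open import Data.Product using (_×_; _,_)
open import Data.Sign as Sign using (Sign)
open import Data.Sum using (inj₁; inj₂)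
open import Relation.Binary.Definitions using (WeaklyDecidable)
open import Relation.Binary.PropositionalEquality using (cong)
open import Relation.Binary.Structures using (IsTotalOrder)
open import Relation.Nullary using (yes; no)

open import Defs

module IntegerCoefficients {c ℓ} (R : CommutativeRing c ℓ) where
  open CommutativeRing R
  open RingProperties ring using (-‿involutive; -‿+-comm; -0#≈0#; -1*x≈-x)
  open import Algebra.Properties.CommutativeSemigroup *-commutativeSemigroup using (interchange)
  open SemiringMult semiring using (×-homo-+; ×1-homo-*) renaming (_×_ to _·_)

  fromSign : Sign → Carrier
  fromSign Sign.+ = 1#
  fromSign Sign.- = - 1#

  -- The clause for + 1 makes the solver constant for 1 definitionally 1#
  -- rather than 1# + 0#.
  fromℤ : ℤ → Carrier
  fromℤ (+ 1)    = 1#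
  fromℤ (+ n)    = n · 1#
  fromℤ -[1+ n ] = - (ℕ.suc n · 1#)

  fromℤ-+ : ∀ n → fromℤ (+ n) ≈ n · 1#
  fromℤ-+ 0                 = refl
  fromℤ-+ 1                 = sym (+-identityʳ 1#)
  fromℤ-+ (ℕ.suc (ℕ.suc n)) = refl

  fromSign-homo-* : ∀ s t → fromSign (s Sign.* t) ≈ fromSign s * fromSign t
  fromSign-homo-* Sign.+ t      = sym (*-identityˡ _)
  fromSign-homo-* Sign.- Sign.+ = sym (*-identityʳ _)
  fromSign-homo-* Sign.- Sign.- = sym (trans (-1*x≈-x (- 1#)) (-‿involutive 1#))

  fromℤ-◃ : ∀ s n → fromℤ (s ◃ n) ≈ fromSign s * (n · 1#)
  fromℤ-◃ s      ℕ.zero    = sym (zeroʳ _)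
  fromℤ-◃ Sign.+ (ℕ.suc n) = trans (fromℤ-+ (ℕ.suc n)) (sym (*-identityˡ _))
  fromℤ-◃ Sign.- (ℕ.suc n) = sym (-1*x≈-x _)

  fromℤ-sign-abs : ∀ i → fromSign (sign i) * (∣ i ∣ · 1#) ≈ fromℤ i
  fromℤ-sign-abs i = trans (sym (fromℤ-◃ (sign i) ∣ i ∣)) (reflexive (cong fromℤ (ℤ.◃-inverse i)))

  fromℤ-homo-* : ∀ i j → fromℤ (i ℤ.* j) ≈ fromℤ i * fromℤ j
  fromℤ-homo-* i j = begin
    fromℤ (sign i Sign.* sign j ◃ ∣ i ∣ ℕ.* ∣ j ∣)
      ≈⟨ fromℤ-◃ (sign i Sign.* sign j) (∣ i ∣ ℕ.* ∣ j ∣) ⟩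
    fromSign (sign i Sign.* sign j) * ((∣ i ∣ ℕ.* ∣ j ∣) · 1#)
      ≈⟨ *-cong (fromSign-homo-* (sign i) (sign j)) (×1-homo-* ∣ i ∣ ∣ j ∣) ⟩
    (fromSign (sign i) * fromSign (sign j)) * ((∣ i ∣ · 1#) * (∣ j ∣ · 1#))
      ≈⟨ interchange _ _ _ _ ⟩
    (fromSign (sign i) * (∣ i ∣ · 1#)) * (fromSign (sign j) * (∣ j ∣ · 1#))
      ≈⟨ *-cong (fromℤ-sign-abs i) (fromℤ-sign-abs j) ⟩
    fromℤ i * fromℤ j
      ∎
    where open import Relation.Binary.Reasoning.Setoid setoid

  1+x-[1+y]≈x-y : ∀ x y → (1# + x) - (1# + y) ≈ x - y
  1+x-[1+y]≈x-y x y = begin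
    (1# + x) + - (1# + y)    ≈⟨ +-cong (+-comm x 1#) (-‿+-comm 1# y) ⟨
    (x + 1#) + (- 1# + - y)  ≈⟨ +-assoc x 1# _ ⟩
    x + (1# + (- 1# + - y))  ≈⟨ +-congˡ (+-assoc 1# (- 1#) (- y)) ⟨
    x + ((1# + - 1#) + - y)  ≈⟨ +-congˡ (+-congʳ (-‿inverseʳ 1#)) ⟩
    x + (0# + - y)           ≈⟨ +-congˡ (+-identityˡ (- y)) ⟩
    x + - y                  ∎
    where open import Relation.Binary.Reasoning.Setoid setoid

  fromℤ-⊖ : ∀ m n → fromℤ (m ℤ.⊖ n) ≈ m · 1# - n · 1#
  fromℤ-⊖ ℕ.zero    ℕ.zero    = sym (trans (+-congˡ -0#≈0#) (+-identityʳ 0#))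
  fromℤ-⊖ (ℕ.suc m) ℕ.zero    = sym (trans (+-congˡ -0#≈0#) (trans (+-identityʳ _) (sym (fromℤ-+ (ℕ.suc m)))))
  fromℤ-⊖ ℕ.zero    (ℕ.suc n) = sym (+-identityˡ _)
  fromℤ-⊖ (ℕ.suc m) (ℕ.suc n) =
    trans (reflexive (cong fromℤ (ℤ.[1+m]⊖[1+n]≡m⊖n m n)))
          (trans (fromℤ-⊖ m n) (sym (1+x-[1+y]≈x-y (m · 1#) (n · 1#))))

  fromℤ-homo-+ : ∀ i j → fromℤ (i ℤ.+ j) ≈ fromℤ i + fromℤ j
  fromℤ-homo-+ (+ m)      (+ n)      =
    trans (fromℤ-+ (m ℕ.+ n)) (trans (×-homo-+ 1# m n) (sym (+-cong (fromℤ-+ m) (fromℤ-+ n))))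
  fromℤ-homo-+ (+ m)      -[1+ n ]   = trans (fromℤ-⊖ m (ℕ.suc n)) (+-congʳ (sym (fromℤ-+ m)))
  fromℤ-homo-+ -[1+ m ]   (+ n)      =
    trans (fromℤ-⊖ n (ℕ.suc m)) (trans (+-comm _ _) (+-congˡ (sym (fromℤ-+ n))))
  fromℤ-homo-+ -[1+ m ]   -[1+ n ]   = begin
    - (ℕ.suc (ℕ.suc (m ℕ.+ n)) · 1#)        ≡⟨ cong (λ k → - (ℕ.suc k · 1#)) (ℕ.+-suc m n) ⟨
    - ((ℕ.suc m ℕ.+ ℕ.suc n) · 1#)          ≈⟨ -‿cong (×-homo-+ 1# (ℕ.suc m) (ℕ.suc n)) ⟩
    - (ℕ.suc m · 1# + ℕ.suc n · 1#)         ≈⟨ -‿+-comm _ _ ⟨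
    - (ℕ.suc m · 1#) + - (ℕ.suc n · 1#)     ∎
    where open import Relation.Binary.Reasoning.Setoid setoid

  fromℤ-homo-neg : ∀ i → fromℤ (ℤ.- i) ≈ - fromℤ i
  fromℤ-homo-neg (+ ℕ.zero)  = sym -0#≈0#
  fromℤ-homo-neg (+ ℕ.suc n) = -‿cong (sym (fromℤ-+ (ℕ.suc n)))
  fromℤ-homo-neg -[1+ n ]    = trans (fromℤ-+ (ℕ.suc n)) (sym (-‿involutive _))

  fromℤ-morphism : ℤ.+-*-rawRing -Raw-AlmostCommutative⟶ fromCommutativeRing R
  fromℤ-morphism = record
    { ⟦_⟧    = fromℤ
    ; +-homo = fromℤ-homo-+
    ; *-homo = fromℤ-homo-*
    ; -‿homo = fromℤ-homo-neg
    ; 0-homo = refl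
    ; 1-homo = refl
    }

  fromℤ-≈? : WeaklyDecidable (λ i j → fromℤ i ≈ fromℤ j)
  fromℤ-≈? i j with i ℤ.≟ j
  ... | yes i≡j = just (reflexive (cong fromℤ i≡j))
  ... | no _    = nothing

  open RingSolver ℤ.+-*-rawRing (fromCommutativeRing R) fromℤ-morphism fromℤ-≈? public

module OrderedFieldProperties {c ℓ₁ ℓ₂} (RF : RealField c ℓ₁ ℓ₂) where
  open RealField RF hiding (zero)
  open IntegerCoefficients commutativeRing using (solve; _:+_; _:*_; :-_; _:=_)
  open RingProperties ring using (-0#≈0#)
  open IsTotalOrder isTotalOrder public using (total)
    renaming (trans to ≤-trans; ≲-respˡ-≈ to ≤-respˡ-≈; ≲-respʳ-≈ to ≤-respʳ-≈)

  -‿antimono : ∀ {x y} → x ≤ y → (- y) ≤ (- x)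
  -‿antimono {x} {y} x≤y =
    ≤-respˡ-≈ (leftSum≈ x y) (≤-respʳ-≈ (rightSum≈ x y) (+-mono-≤ (- x + - y) x≤y))
    where
    leftSum≈ : ∀ x y → x + (- x + - y) ≈ - y
    leftSum≈ = solve 2 (λ x y → x :+ (:- x :+ :- y) := :- y) refl
    rightSum≈ : ∀ x y → y + (- x + - y) ≈ - x
    rightSum≈ = solve 2 (λ x y → y :+ (:- x :+ :- y) := :- x) refl

  x≤0⇒0≤-x : ∀ {x} → x ≤ 0# → 0# ≤ (- x)
  x≤0⇒0≤-x x≤0 = ≤-respˡ-≈ -0#≈0# (-‿antimono x≤0)

  0≤x⇒-x≤0 : ∀ {x} → 0# ≤ x → (- x) ≤ 0#
  0≤x⇒-x≤0 0≤x = ≤-respʳ-≈ -0#≈0# (-‿antimono 0≤x)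

  x*x-nonneg : ∀ x → 0# ≤ (x * x)
  x*x-nonneg x with total 0# x
  ... | inj₁ 0≤x = *-nonneg 0≤x 0≤x
  ... | inj₂ x≤0 = ≤-respʳ-≈ (-x*-x≈x*x x) (*-nonneg (x≤0⇒0≤-x x≤0) (x≤0⇒0≤-x x≤0))
    where
    -x*-x≈x*x : ∀ x → - x * - x ≈ x * x
    -x*-x≈x*x = solve 1 (λ x → :- x :* :- x := x :* x) refl

  +-nonneg : ∀ {x y} → 0# ≤ x → 0# ≤ y → 0# ≤ (x + y)
  +-nonneg {x} {y} 0≤x 0≤y = ≤-trans (≤-respʳ-≈ (sym (+-identityˡ y)) 0≤y) (+-mono-≤ y 0≤x)

module DiscriminantSumsOfSquares {c ℓ₁ ℓ₂} (RF : RealField c ℓ₁ ℓ₂) where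
  open RealField RF hiding (zero)
  open RealDefs RF
  open IntegerCoefficients commutativeRing
    using (solve; Polynomial; con; _:+_; _:-_; _:*_; :-_; _:=_)

  κ : ∀ {q} → ℕ → Polynomial q
  κ k = con (+ k)

  discCubicₚ : ∀ {q} → Polynomial q → Polynomial q → Polynomial q → Polynomial q
  discCubicₚ b c' d =
    κ 18 :* b :* c' :* d :- κ 4 :* (b :* b :* b) :* d :+ b :* b :* (c' :* c')
    :- κ 4 :* (c' :* c' :* c') :- κ 27 :* (d :* d)

  -- Δ with the entries of M spelled out, so that it evaluates definitionally to Δ m n.
  Δₚ : ∀ {q} → Polynomial q → Polynomial q → Polynomial q
  Δₚ m n = discCubicₚ
    (:- (κ 0 :+ κ 0 :+ n))
    ((κ 0 :* κ 0 :- κ 0 :* κ 1) :+ (κ 0 :* n :- κ 1 :* κ 0) :+ (κ 0 :* n :- m :* κ 1))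
    (:- (κ 0 :* (κ 0 :* n :- m :* κ 1) :- κ 0 :* (κ 1 :* n :- m :* κ 0)
         :+ κ 1 :* (κ 1 :* κ 1 :- κ 0 :* κ 0)))

  first-quartic≈Δ+squares : ∀ m n →
    (m * m - lit 4 * n + lit 3) * (n * n + lit 4 * m + lit 3)
      ≈ Δ m n + ((m + n) * (m + n) + (m + n) * (m + n) + (m - n + lit 6) * (m - n + lit 6))
  first-quartic≈Δ+squares = solve 2 (λ m n →
    (m :* m :- κ 4 :* n :+ κ 3) :* (n :* n :+ κ 4 :* m :+ κ 3)
      := Δₚ m n :+ ((m :+ n) :* (m :+ n) :+ (m :+ n) :* (m :+ n) :+ (m :- n :+ κ 6) :* (m :- n :+ κ 6)))
    refl

  second-quartic≈Δ-squares : ∀ m n →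
    (m * m - lit 4 * n - lit 3) * (n * n + lit 4 * m - lit 3) - lit 72
      ≈ Δ m n - ((m + n) * (m + n) + (m - n + lit 3) * (m - n + lit 3) + (m - n + lit 3) * (m - n + lit 3)
                 + lit 3 * lit 3 + lit 3 * lit 3)
  second-quartic≈Δ-squares = solve 2 (λ m n →
    (m :* m :- κ 4 :* n :- κ 3) :* (n :* n :+ κ 4 :* m :- κ 3) :- κ 72
      := Δₚ m n :- ((m :+ n) :* (m :+ n) :+ (m :- n :+ κ 3) :* (m :- n :+ κ 3) :+ (m :- n :+ κ 3) :* (m :- n :+ κ 3)
                    :+ κ 3 :* κ 3 :+ κ 3 :* κ 3))
    refl

mainTheorem4 : ∀ {c ℓ₁ ℓ₂} (R : RealField c ℓ₁ ℓ₂) →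
    let open RealField R
        open RealDefs R
    in ∀ (m n : Carrier) → Δ m n ≈ 0# →
         (0# ≤ ((m * m - lit 4 * n + lit 3) * (n * n + lit 4 * m + lit 3)))
         × (((m * m - lit 4 * n - lit 3) * (n * n + lit 4 * m - lit 3) - lit 72) ≤ 0#)
mainTheorem4 R m n Δ≈0 =
    ≤-respʳ-≈ (sym (onCurve (first-quartic≈Δ+squares m n))) first-squares-nonneg
  , ≤-respˡ-≈ (sym (onCurve (second-quartic≈Δ-squares m n))) (0≤x⇒-x≤0 second-squares-nonneg)
  where
  open RealField R
  open RealDefs R
  open OrderedFieldProperties R
  open DiscriminantSumsOfSquares R

  onCurve : ∀ {x s} → x ≈ Δ m n + s → x ≈ s
  onCurve {s = s} x≈Δ+s = trans x≈Δ+s (trans (+-congʳ Δ≈0) (+-identityˡ s))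

  first-squares-nonneg : 0# ≤ ((m + n) * (m + n) + (m + n) * (m + n) + (m - n + lit 6) * (m - n + lit 6))
  first-squares-nonneg =
    +-nonneg (+-nonneg (x*x-nonneg (m + n)) (x*x-nonneg (m + n))) (x*x-nonneg (m - n + lit 6))

  second-squares-nonneg : 0# ≤ ((m + n) * (m + n) + (m - n + lit 3) * (m - n + lit 3)
                                + (m - n + lit 3) * (m - n + lit 3) + lit 3 * lit 3 + lit 3 * lit 3)
  second-squares-nonneg =
    +-nonneg (+-nonneg (+-nonneg (+-nonneg (x*x-nonneg (m + n)) (x*x-nonneg (m - n + lit 3)))
                                 (x*x-nonneg (m - n + lit 3)))
                       (x*x-nonneg (lit 3)))
             (x*x-nonneg (lit 3))
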